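{- For $\sigma,\tau\in\mathbb{T}_C$, we have $\sigma\le\tau$ if and only if for each path $\pi\in\mathbb{P}(\tau)$ there exists a path $\pi'\in\mathbb{P}(\sigma)$ such that $\pi'\le\pi$ and: if $\pi\equiv\alpha$ (resp. $\pi\equiv a$) then $\pi'\equiv\alpha$ (resp. $\pi'\equiv a$); if $\pi\equiv\sigma_2\to\tau_2$ then $\pi'\equiv\sigma_1\to\tau_1$ with $\sigma_2\le\sigma_1$ and $\tau_1\le\tau_2$; if $\pi\equiv c(\tau_1)$ then $\pi'\equiv c(\sigma_1)$ with $\sigma_1\le\tau_1$.
   Context: Types $\mathbb{T}_C$: $\tau::=a\mid\alpha\mid\omega\mid\tau_1\to\tau_2\mid\tau_1\cap\tau_2\mid c(\tau)$ ($a$ constants, $\alpha$ type variables, $c$ unary constructors). Subtyping $\le$: least preorder with $\sigma\le\omega$; $\omega\le\omega\to\omega$; $\sigma\cap\tau\le\sigma$; $\sigma\cap\tau\le\tau$; $\sigma\le\tau_1,\sigma\le\tau_2\Rightarrow\sigma\le\tau_1\cap\tau_2$; $(\sigma\to\tau_1)\cap(\sigma\to\tau_2)\le\sigma\to\tau_1\cap\tau_2$; $\sigma_2\le\sigma_1,\tau_1\le\tau_2\Rightarrow\sigma_1\to\tau_1\le\sigma_2\to\tau_2$; $\tau_1\le\tau_2\Rightarrow c(\tau_1)\le c(\tau_2)$; $c(\tau_1)\cap c(\tau_2)\le c(\tau_1\cap\tau_2)$. Paths: $\pi::=a\mid\alpha\mid\sigma\to\pi\mid c(\omega)\mid c(\pi)$.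 $\mathbb{P}(a)=\{a\}$, $\mathbb{P}(\alpha)=\{\alpha\}$, $\mathbb{P}(\omega)=\emptyset$, $\mathbb{P}(\sigma\to\tau)=\{\sigma\to\pi\mid\pi\in\mathbb{P}(\tau)\}$, $\mathbb{P}(\sigma\cap\tau)=\mathbb{P}(\sigma)\cup\mathbb{P}(\tau)$, $\mathbb{P}(c(\tau))=\{c(\omega)\}$ if $\mathbb{P}(\tau)=\emptyset$, else $\{c(\pi)\mid\pi\in\mathbb{P}(\tau)\}$. $\equiv$ is syntactic identity. -}

module Defs where

open import Data.List using (List; []; _∷_; map; _++_)
open import Data.List.Membership.Propositional using (_∈_)
open import Data.Product using (Σ; ∃; ∃-syntax; _×_; _,_)
open import Relation.Binary.PropositionalEquality using (_≡_)

data Ty (A V C : Set) : Set where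
  const : A → Ty A V C
  var   : V → Ty A V C
  ω     : Ty A V C
  _⇒_   : Ty A V C → Ty A V C → Ty A V C
  _∩_   : Ty A V C → Ty A V C → Ty A V C
  con   : C → Ty A V C → Ty A V C

infixr 7 _⇒_
infixl 8 _∩_
infix 4 _≤_

data _≤_ {A V C : Set} : Ty A V C → Ty A V C → Set where
  ≤-refl    : ∀ {σ} → σ ≤ σ
  ≤-trans   : ∀ {σ τ ρ} → σ ≤ τ → τ ≤ ρ → σ ≤ ρ
  ≤-ω       : ∀ {σ} → σ ≤ ω
  ω≤ω⇒ω     : ω ≤ ω ⇒ ω
  ∩≤ˡ       : ∀ {σ τ} → σ ∩ τ ≤ σ
  ∩≤ʳ       : ∀ {σ τ} → σ ∩ τ ≤ τ
  ≤∩        : ∀ {σ τ₁ τ₂} → σ ≤ τ₁ → σ ≤ τ₂ → σ ≤ τ₁ ∩ τ₂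
  ⇒-∩       : ∀ {σ τ₁ τ₂} → (σ ⇒ τ₁) ∩ (σ ⇒ τ₂) ≤ σ ⇒ (τ₁ ∩ τ₂)
  ⇒-mono    : ∀ {σ₁ σ₂ τ₁ τ₂} → σ₂ ≤ σ₁ → τ₁ ≤ τ₂ → σ₁ ⇒ τ₁ ≤ σ₂ ⇒ τ₂
  con-mono  : ∀ {c τ₁ τ₂} → τ₁ ≤ τ₂ → con c τ₁ ≤ con c τ₂
  con-∩     : ∀ {c τ₁ τ₂} → con c τ₁ ∩ con c τ₂ ≤ con c (τ₁ ∩ τ₂)

conPaths : {A V C : Set} → C → List (Ty A V C) → List (Ty A V C)
conPaths c [] = con c ω ∷ []
conPaths c (π ∷ πs) = map (con c) (π ∷ πs)

P : {A V C : Set} → Ty A V C → List (Ty A V C)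
P (const a) = const a ∷ []
P (var α)   = var α ∷ []
P ω         = []
P (σ ⇒ τ)   = map (σ ⇒_) (P τ)
P (σ ∩ τ)   = P σ ++ P τ
P (con c τ) = conPaths c (P τ)

Shape : {A V C : Set} → Ty A V C → Ty A V C → Set
Shape {A} {V} {C} π′ π =
    (∀ (α : V) → π ≡ var α → π′ ≡ var α)
  × (∀ (a : A) → π ≡ const a → π′ ≡ const a)
  × (∀ (σ₂ τ₂ : Ty A V C) → π ≡ σ₂ ⇒ τ₂ →
       ∃[ σ₁ ] ∃[ τ₁ ] (π′ ≡ σ₁ ⇒ τ₁ × σ₂ ≤ σ₁ × τ₁ ≤ τ₂))
  × (∀ (c : C) (τ₁ : Ty A V C) → π ≡ con c τ₁ →
       ∃[ σ₁ ] (π′ ≡ con c σ₁ × σ₁ ≤ τ₁))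

-- Soundness: reading σ ≤ τ as "every path of τ is matched by a path of σ",
-- the path relation is a preorder that validates every subtyping axiom,
-- so it contains ≤. Completeness: every type lies below each of its paths
-- and above the intersection of its paths (ω when there are none), so if
-- each path of τ is above some path of σ, then σ ≤ ⋂ P(τ) ≤ τ.
module Submission where

open import Defs
open import Data.List using (List; []; _∷_; map; _++_)
open import Data.List.Properties using (map-++)
open import Data.List.Membership.Propositional using (_∈_)
open import Data.List.Membership.Propositional.Properties using (∈-map⁺; ∈-map⁻; ∈-++⁻)
open import Data.List.Relation.Binary.Subset.Propositional using (_⊆_)
open import Data.List.Relation.Binary.Subset.Propositional.Properties
  using (⊆-refl; ⊆-reflexive; ⊆-trans; xs⊆x∷xs; xs⊆xs++ys; xs⊆ys++xs; ++⁺ʳ)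
open import Data.List.Relation.Unary.Any using (here; there)
open import Data.Product using (∃-syntax; _×_; _,_)
open import Data.Sum using (inj₁; inj₂)
open import Function using (_∘′_)
open import Function.Bundles using (_⇔_; mk⇔)
open import Relation.Binary.PropositionalEquality using (refl)

private
  variable
    A V C : Set
    c : C
    π π′ π″ σ σ₁ σ₂ τ τ₁ τ₂ : Ty A V C
    xs ys zs : List (Ty A V C)

Shape-refl : Shape π π
Shape-refl =
  (λ _ eq → eq) , (λ _ eq → eq) ,
  (λ σ τ eq → σ , τ , eq , ≤-refl , ≤-refl) , (λ _ τ eq → τ , eq , ≤-refl)

Shape-trans : Shape π′ π″ → Shape π″ π → Shape π′ π
Shape-trans (var₁ , const₁ , arr₁ , con₁) (var₂ , const₂ , arr₂ , con₂) =
    (λ α eq → var₁ α (var₂ α eq))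
  , (λ a eq → const₁ a (const₂ a eq))
  , (λ σ τ eq → let σ′ , τ′ , eq′ , σ≤σ′ , τ′≤τ = arr₂ σ τ eq
                    σ″ , τ″ , eq″ , σ′≤σ″ , τ″≤τ′ = arr₁ σ′ τ′ eq′
                in σ″ , τ″ , eq″ , ≤-trans σ≤σ′ σ′≤σ″ , ≤-trans τ″≤τ′ τ′≤τ)
  , (λ c τ eq → let τ′ , eq′ , τ′≤τ = con₂ c τ eq
                    τ″ , eq″ , τ″≤τ′ = con₁ c τ′ eq′
                in τ″ , eq″ , ≤-trans τ″≤τ′ τ′≤τ)

Shape-⇒ : σ₂ ≤ σ₁ → τ₁ ≤ τ₂ → Shape (σ₁ ⇒ τ₁) (σ₂ ⇒ τ₂)
Shape-⇒ {σ₁ = σ₁} {τ₁ = τ₁} σ₂≤σ₁ τ₁≤τ₂ =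
  (λ _ ()) , (λ _ ()) , (λ { _ _ refl → σ₁ , τ₁ , refl , σ₂≤σ₁ , τ₁≤τ₂ }) , (λ _ _ ())

Shape-con : τ₁ ≤ τ₂ → Shape (con c τ₁) (con c τ₂)
Shape-con {τ₁ = τ₁} τ₁≤τ₂ =
  (λ _ ()) , (λ _ ()) , (λ _ _ ()) , (λ { _ _ refl → τ₁ , refl , τ₁≤τ₂ })

infix 4 _≼_

_≼_ : List (Ty A V C) → List (Ty A V C) → Set
xs ≼ ys = ∀ π → π ∈ ys → ∃[ π′ ] (π′ ∈ xs × π′ ≤ π × Shape π′ π)

⊇⇒≼ : ys ⊆ xs → xs ≼ ys
⊇⇒≼ ys⊆xs π π∈ys = π , ys⊆xs π∈ys , ≤-refl , Shape-refl

≼-refl : xs ≼ xs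
≼-refl = ⊇⇒≼ ⊆-refl

≼-trans : xs ≼ ys → ys ≼ zs → xs ≼ zs
≼-trans xs≼ys ys≼zs π π∈zs =
  let π″ , π″∈ys , π″≤π , shape″ = ys≼zs π π∈zs
      π′ , π′∈xs , π′≤π″ , shape′ = xs≼ys π″ π″∈ys
  in π′ , π′∈xs , ≤-trans π′≤π″ π″≤π , Shape-trans shape′ shape″

≼-++ : xs ≼ ys → xs ≼ zs → xs ≼ ys ++ zs
≼-++ {ys = ys} xs≼ys xs≼zs π π∈ys++zs with ∈-++⁻ ys π∈ys++zs
... | inj₁ π∈ys = xs≼ys π π∈ys
... | inj₂ π∈zs = xs≼zs π π∈zs

≼-map-⇒ : σ₂ ≤ σ₁ → xs ≼ ys → map (σ₁ ⇒_) xs ≼ map (σ₂ ⇒_) ys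
≼-map-⇒ {σ₂ = σ₂} {σ₁ = σ₁} σ₂≤σ₁ xs≼ys _ π∈ys with ∈-map⁻ (σ₂ ⇒_) π∈ys
... | π , π∈ys′ , refl =
  let π′ , π′∈xs , π′≤π , _ = xs≼ys π π∈ys′
  in σ₁ ⇒ π′ , ∈-map⁺ (σ₁ ⇒_) π′∈xs , ⇒-mono σ₂≤σ₁ π′≤π , Shape-⇒ σ₂≤σ₁ π′≤π

map-con⊆conPaths : (xs : List (Ty A V C)) → map (con c) xs ⊆ conPaths c xs
map-con⊆conPaths []      ()
map-con⊆conPaths (_ ∷ _) = ⊆-refl

conPaths-++ : (xs : List (Ty A V C)) → conPaths c (xs ++ ys) ⊆ conPaths c xs ++ conPaths c ys
conPaths-++ {ys = ys} []      = xs⊆x∷xs (conPaths _ ys) _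
conPaths-++ {c = c} {ys = ys} (x ∷ xs) =
  ⊆-trans (⊆-reflexive (map-++ (con c) (x ∷ xs) ys))
          (++⁺ʳ (map (con c) (x ∷ xs)) (map-con⊆conPaths ys))

≼-conPaths : (xs ys : List (Ty A V C)) → xs ≼ ys → conPaths c xs ≼ conPaths c ys
≼-conPaths {c = c} xs [] _ _ (here refl) with xs
... | []    = con c ω , here refl , ≤-refl , Shape-refl
... | x ∷ _ = con c x , here refl , con-mono ≤-ω , Shape-con ≤-ω
≼-conPaths {c = c} xs (y ∷ ys) xs≼ys _ π∈ys with ∈-map⁻ (con c) π∈ys
... | π , π∈ys′ , refl =
  let π′ , π′∈xs , π′≤π , _ = xs≼ys π π∈ys′
  in con c π′ , map-con⊆conPaths xs (∈-map⁺ (con c) π′∈xs) , con-mono π′≤π , Shape-con π′≤π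

≤⇒≼ : σ ≤ τ → P σ ≼ P τ
≤⇒≼ ≤-refl                        = ≼-refl
≤⇒≼ (≤-trans σ≤τ τ≤ρ)             = ≼-trans (≤⇒≼ σ≤τ) (≤⇒≼ τ≤ρ)
≤⇒≼ ≤-ω                           = λ _ ()
≤⇒≼ ω≤ω⇒ω                         = λ _ ()
≤⇒≼ ∩≤ˡ                           = ⊇⇒≼ (xs⊆xs++ys _ _)
≤⇒≼ (∩≤ʳ {σ})                     = ⊇⇒≼ (xs⊆ys++xs _ (P σ))
≤⇒≼ (≤∩ σ≤τ₁ σ≤τ₂)                = ≼-++ (≤⇒≼ σ≤τ₁) (≤⇒≼ σ≤τ₂)
≤⇒≼ (⇒-∩ {σ} {τ₁} {τ₂})           = ⊇⇒≼ (⊆-reflexive (map-++ (σ ⇒_) (P τ₁) (P τ₂)))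
≤⇒≼ (⇒-mono σ₂≤σ₁ τ₁≤τ₂)          = ≼-map-⇒ σ₂≤σ₁ (≤⇒≼ τ₁≤τ₂)
≤⇒≼ (con-mono {τ₁ = τ₁} {τ₂} τ₁≤τ₂) = ≼-conPaths (P τ₁) (P τ₂) (≤⇒≼ τ₁≤τ₂)
≤⇒≼ (con-∩ {τ₁ = τ₁})             = ⊇⇒≼ (conPaths-++ (P τ₁))

⋂ : List (Ty A V C) → Ty A V C
⋂ []       = ω
⋂ (x ∷ xs) = x ∩ ⋂ xs

⋂-lower : π ∈ xs → ⋂ xs ≤ π
⋂-lower (here refl) = ∩≤ˡ
⋂-lower (there π∈xs) = ≤-trans ∩≤ʳ (⋂-lower π∈xs)

⋂-greatest : (xs : List (Ty A V C)) → (∀ {π} → π ∈ xs → σ ≤ π) → σ ≤ ⋂ xs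
⋂-greatest []       _     = ≤-ω
⋂-greatest (x ∷ xs) σ≤xs = ≤∩ (σ≤xs (here refl)) (⋂-greatest xs (σ≤xs ∘′ there))

⋂-antitone : ys ⊆ xs → ⋂ xs ≤ ⋂ ys
⋂-antitone {ys = ys} ys⊆xs = ⋂-greatest ys (λ π∈ys → ⋂-lower (ys⊆xs π∈ys))

∩-mono : σ₁ ≤ σ₂ → τ₁ ≤ τ₂ → σ₁ ∩ τ₁ ≤ σ₂ ∩ τ₂
∩-mono σ₁≤σ₂ τ₁≤τ₂ = ≤∩ (≤-trans ∩≤ˡ σ₁≤σ₂) (≤-trans ∩≤ʳ τ₁≤τ₂)

⋂-map-⇒ : (xs : List (Ty A V C)) → ⋂ (map (σ ⇒_) xs) ≤ σ ⇒ ⋂ xs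
⋂-map-⇒ []       = ≤-trans ω≤ω⇒ω (⇒-mono ≤-ω ≤-refl)
⋂-map-⇒ (x ∷ xs) = ≤-trans (∩-mono ≤-refl (⋂-map-⇒ xs)) ⇒-∩

⋂-conPaths : (xs : List (Ty A V C)) → ⋂ (conPaths c xs) ≤ con c (⋂ xs)
⋂-conPaths []           = ∩≤ˡ
⋂-conPaths (x ∷ [])     = ≤-trans ∩≤ˡ (con-mono (≤∩ ≤-refl ≤-ω))
⋂-conPaths (x ∷ y ∷ xs) = ≤-trans (∩-mono ≤-refl (⋂-conPaths (y ∷ xs))) con-∩

⋂-paths≤ : (τ : Ty A V C) → ⋂ (P τ) ≤ τ
⋂-paths≤ (const a) = ∩≤ˡ
⋂-paths≤ (var α)   = ∩≤ˡ
⋂-paths≤ ω         = ≤-refl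
⋂-paths≤ (σ ⇒ τ)   = ≤-trans (⋂-map-⇒ (P τ)) (⇒-mono ≤-refl (⋂-paths≤ τ))
⋂-paths≤ (σ ∩ τ)   =
  ≤-trans (≤∩ (⋂-antitone (xs⊆xs++ys (P σ) (P τ))) (⋂-antitone (xs⊆ys++xs (P τ) (P σ))))
          (∩-mono (⋂-paths≤ σ) (⋂-paths≤ τ))
⋂-paths≤ (con c τ) = ≤-trans (⋂-conPaths (P τ)) (con-mono (⋂-paths≤ τ))

conPaths-lower : (xs : List (Ty A V C)) → (∀ {π} → π ∈ xs → τ ≤ π) →
                 π ∈ conPaths c xs → con c τ ≤ π
conPaths-lower []       _     (here refl) = con-mono ≤-ω
conPaths-lower {c = c} (x ∷ xs) τ≤xs π∈ps with ∈-map⁻ (con c) π∈ps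
... | _ , π∈xs , refl = con-mono (τ≤xs π∈xs)

≤-path : (τ : Ty A V C) → π ∈ P τ → τ ≤ π
≤-path (const a) (here refl) = ≤-refl
≤-path (var α)   (here refl) = ≤-refl
≤-path (σ ⇒ τ)   π∈Pσ⇒τ with ∈-map⁻ (σ ⇒_) π∈Pσ⇒τ
... | _ , π∈Pτ , refl = ⇒-mono ≤-refl (≤-path τ π∈Pτ)
≤-path (σ ∩ τ)   π∈Pσ∩τ with ∈-++⁻ (P σ) π∈Pσ∩τ
... | inj₁ π∈Pσ = ≤-trans ∩≤ˡ (≤-path σ π∈Pσ)
... | inj₂ π∈Pτ = ≤-trans ∩≤ʳ (≤-path τ π∈Pτ)
≤-path (con c τ) π∈Pcτ = conPaths-lower (P τ) (≤-path τ) π∈Pcτ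

≼⇒≤ : (σ τ : Ty A V C) → P σ ≼ P τ → σ ≤ τ
≼⇒≤ σ τ σ≼τ = ≤-trans (⋂-greatest (P τ) σ≤path) (⋂-paths≤ τ)
  where
    σ≤path : ∀ {π} → π ∈ P τ → σ ≤ π
    σ≤path {π} π∈Pτ = let _ , π′∈Pσ , π′≤π , _ = σ≼τ π π∈Pτ in ≤-trans (≤-path σ π′∈Pσ) π′≤π

lemma4p10 : {A V C : Set} (σ τ : Ty A V C) →
    (σ ≤ τ) ⇔ (∀ π → π ∈ P τ → ∃[ π′ ] (π′ ∈ P σ × π′ ≤ π × Shape π′ π))
lemma4p10 σ τ = mk⇔ ≤⇒≼ (≼⇒≤ σ τ)
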